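{- Let $\mathcal G\le S_\infty$ be a cofinitary group and let $\mathbb Q_{\mathcal G}$ be the forcing defined below. For any $n\in\mathbb N$, the set of $q\in\mathbb Q_{\mathcal G}$ such that $n\in\operatorname{dom}(s^q)$ is dense in $\mathbb Q_{\mathcal G}$.
   Context: $S_\infty$ is the group of permutations of $\mathbb N$ with identity $\mathbf 1$; a subgroup is cofinitary if each non-identity element has only finitely many fixed points. $W_{\mathcal G,X}$ is the set of reduced words over the alphabet $(\mathcal G\setminus\{\mathbf 1\})\cup\{X,X^{ -1}\}$ (i.e. the free product $\mathcal G*\mathbb F(X)$ in normal form, with $\emptyset$ the empty word); elements of $\mathcal G$ are identified with words of length at most one. For an injective partial function $s:\mathbb N\rightharpoonup\mathbb N$ and $w\in W_{\mathcal G,X}$, $w[s]$ is the partial function obtained from $w$ by substituting $s$ for $X$ and its partial inverse $s^{ -1}$ for $X^{ -1}$ and composing partial functions; $\emptyset[s]$ is the identity. $\mathrm{fix}(a)=\{n: a(n)=n\}$. A subword of $w=a_n\cdots a_1$ is a contiguous subword $a_i\cdots a_j$ ($n\ge i\ge j\ge 1$) or the empty word. For nonempty $w=a_n\cdots a_1$ and $m\in\mathbb N$, the path $\mathrm{path}(w,s,m)=\langle m_i:i<\alpha\rangle$ is defined by $m_0=m$ and $m_{i+1}=a_j[s](m_i)$ where $1\le j\le n$, $j\equiv i+1\pmod n$ (letters are applied right to left, cyclically), with $\alpha\le\omega$ maximal such that all terms are defined; $\mathrm{set}(w,s,m)=\{m_i:i<\alpha\}$. The forcing $\mathbb Q_{\mathcal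 G}$: conditions are pairs $p=(s^p,F^p)$ with $s^p$ a finite injective partial function from $\mathbb N$ to $\mathbb N$ and $F^p\subseteq W_{\mathcal G,X}\setminus\mathcal G$ finite; $(s^q,F^q)\le(s^p,F^p)$ iff $s^q\supseteq s^p$, $F^q\supseteq F^p$, and for every $w\in F^p$ and every $m\in\mathrm{fix}(w[s^q])$ there is a nonempty subword $w'$ of $w$ with $\mathrm{set}(w,s^q,m)\cap\mathrm{fix}(w'[s^p])\neq\emptyset$. -}

module Defs where

open import Data.Nat using (ℕ; zero; suc; _<_)
open import Data.Nat.DivMod using (_%_)
open import Data.List using (List; []; _∷_; _++_; reverse; length)
open import Data.List.Membership.Propositional using (_∈_)
open import Data.List.Relation.Unary.All using (All)
open import Data.List.Relation.Binary.Pointwise using (Pointwise)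
open import Data.Maybe using (Maybe; just; nothing)
open import Data.Product using (Σ; ∃; _×_; _,_)
open import Data.Sum using (_⊎_)
open import Data.Unit using (⊤)
open import Data.Empty using (⊥)
open import Relation.Nullary using (¬_)
open import Relation.Binary.PropositionalEquality using (_≡_)

record Perm : Set where
  field
    to      : ℕ → ℕ
    from    : ℕ → ℕ
    to-from : ∀ n → to (from n) ≡ n
    from-to : ∀ n → from (to n) ≡ n
open Perm public

idPerm : Perm
idPerm = record { to = λ n → n ; from = λ n → n
                ; to-from = λ _ → Relation.Binary.PropositionalEquality.refl
                ; from-to = λ _ → Relation.Binary.PropositionalEquality.refl }

_∘P_ : Perm → Perm → Perm
σ ∘P τ = record
  { to = λ n → to σ (to τ n) ; from = λ n → from τ (from σ n)
  ; to-from = λ n → Relation.Binary.PropositionalEquality.trans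
                      (Relation.Binary.PropositionalEquality.cong (to σ) (to-from τ (from σ n))) (to-from σ n)
  ; from-to = λ n → Relation.Binary.PropositionalEquality.trans
                      (Relation.Binary.PropositionalEquality.cong (from τ) (from-to σ (to τ n))) (from-to τ n) }

invP : Perm → Perm
invP σ = record { to = from σ ; from = to σ ; to-from = from-to σ ; from-to = to-from σ }

IsId : Perm → Set
IsId σ = ∀ n → to σ n ≡ n

_≈P_ : Perm → Perm → Set
σ ≈P τ = ∀ n → to σ n ≡ to τ n

record IsSubgroup (G : Perm → Set) : Set where
  field
    resp  : ∀ {σ τ} → σ ≈P τ → G σ → G τ
    has-1 : G idPerm
    has-∘ : ∀ {σ τ} → G σ → G τ → G (σ ∘P τ)
    has-⁻ : ∀ {σ} → G σ → G (invP σ)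

Cofinitary : (Perm → Set) → Set
Cofinitary G = ∀ σ → G σ → ¬ IsId σ → Σ ℕ λ N → ∀ n → to σ n ≡ n → n < N

data Letter (G : Perm → Set) : Set where
  gl  : (σ : Perm) → G σ → ¬ IsId σ → Letter G
  X   : Letter G
  X⁻¹ : Letter G

-- A word a_n ⋯ a_1 is the list (a_n ∷ ⋯ ∷ a_1 ∷ []) : written order,
-- a_1 (the last list element) is applied first.
Word : (Perm → Set) → Set
Word G = List (Letter G)

OkPair : ∀ {G} → Letter G → Letter G → Set
OkPair (gl _ _ _) (gl _ _ _) = ⊥
OkPair X X⁻¹ = ⊥
OkPair X⁻¹ X = ⊥
OkPair _ _ = ⊤

Reduced : ∀ {G} → Word G → Set
Reduced [] = ⊤
Reduced (a ∷ []) = ⊤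
Reduced (a ∷ b ∷ w) = OkPair a b × Reduced (b ∷ w)

InG : ∀ {G} → Word G → Set
InG {G} w = (w ≡ []) ⊎ (Σ Perm λ σ → Σ (G σ) λ g → Σ (¬ IsId σ) λ ne → w ≡ gl σ g ne ∷ [])

-- extensional equality of letters / words (words as elements of W_{G,X})
LetterEq : ∀ {G} → Letter G → Letter G → Set
LetterEq (gl σ _ _) (gl τ _ _) = σ ≈P τ
LetterEq X X = ⊤
LetterEq X⁻¹ X⁻¹ = ⊤
LetterEq _ _ = ⊥

WordEq : ∀ {G} → Word G → Word G → Set
WordEq = Pointwise LetterEq

_∈W_ : ∀ {G} → Word G → List (Word G) → Set
w ∈W F = Σ _ λ v → v ∈ F × WordEq w v

-- finite partial functions ℕ ⇀ ℕ as finite graphs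

PFun : Set
PFun = List (ℕ × ℕ)

Functional : PFun → Set
Functional s = ∀ {a b c} → (a , b) ∈ s → (a , c) ∈ s → b ≡ c

Injective : PFun → Set
Injective s = ∀ {a b c} → (a , c) ∈ s → (b , c) ∈ s → a ≡ b

Step : ∀ {G} → Letter G → PFun → ℕ → ℕ → Set
Step (gl σ _ _) s x y = y ≡ to σ x
Step X s x y = (x , y) ∈ s
Step X⁻¹ s x y = (y , x) ∈ s

-- w[s](m) = k   (letters applied right to left; ∅[s] is the identity)
Eval : ∀ {G} → Word G → PFun → ℕ → ℕ → Set
Eval [] s m k = k ≡ m
Eval (a ∷ w) s m k = Σ ℕ λ l → Eval w s m l × Step a s l k

Fix : ∀ {G} → Word G → PFun → ℕ → Set
Fix w s m = Eval w s m m

nth : ∀ {A : Set} → List A → ℕ → Maybe A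
nth [] _ = nothing
nth (a ∷ as) zero = just a
nth (a ∷ as) (suc i) = nth as i

-- the letter used in step i → i+1 of the path, i.e. a_j with j ≡ i+1 mod n
cycNth : ∀ {A : Set} → List A → ℕ → Maybe A
cycNth [] i = nothing
cycNth (a ∷ as) i = nth (a ∷ as) (i % suc (length as))

-- PathAt w s m i k : the i-th term m_i of path(w,s,m) is defined and equals k
data PathAt {G} (w : Word G) (s : PFun) (m : ℕ) : ℕ → ℕ → Set where
  p0 : PathAt w s m zero m
  pS : ∀ {i x y a} → PathAt w s m i x → cycNth (reverse w) i ≡ just a →
       Step a s x y → PathAt w s m (suc i) y

InSet : ∀ {G} → Word G → PFun → ℕ → ℕ → Set
InSet w s m k = Σ ℕ λ i → PathAt w s m i k

NonemptySubword : ∀ {G} → Word G → Word G → Set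
NonemptySubword w' w = ¬ (w' ≡ []) × Σ _ λ u → Σ _ λ v → w ≡ u ++ (w' ++ v)

record Cond (G : Perm → Set) : Set where
  field
    s     : PFun
    s-fun : Functional s
    s-inj : Injective s
    F     : List (Word G)
    F-ok  : All (λ w → Reduced w × ¬ InG w) F
open Cond public

_⊆P_ : PFun → PFun → Set
s ⊆P t = ∀ {x} → x ∈ s → x ∈ t

_≤Q_ : ∀ {G} → Cond G → Cond G → Set
q ≤Q p =
  (s p ⊆P s q) ×
  (∀ {w} → w ∈ F p → w ∈W F q) ×
  (∀ {w} → w ∈ F p → ∀ m → Fix w (s q) m →
     Σ _ λ w' → NonemptySubword w' w ×
       Σ ℕ λ k → InSet w (s q) m k × Fix w' (s p) k)

Dense : ∀ {G} → (Cond G → Set) → Set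
Dense {G} D = ∀ (p : Cond G) → Σ (Cond G) λ q → (q ≤Q p) × D q

InDom : ∀ {G} → ℕ → Cond G → Set
InDom n q = Σ ℕ λ k → (n , k) ∈ s q

-- If n is already in dom(s^p) then p itself is in the dense set.  Otherwise
-- we extend s = s^p by one new pair (n , k), keeping F^p, where k is chosen
-- outside a finite forbidden set: k avoids U = {n} ∪ dom s ∪ ran s, every
-- G-letter σ occurring in F^p moves k (this is where cofinitarity is used),
-- and σ and every product στ of two such letters map k outside U and U
-- away from k.  Such a k isolates the new pair: a path of w under
-- s' = s ∪ {(n , k)} that starts in U either never uses the new pair, or
-- ends right after it as  n ─X→ k  or  n ─X→ k ─τ→ τk  (Trace).  A case
-- analysis on the first one or two letters of w applied to a fixed point m
-- then shows that either m is already a fixed point of w[s], or the path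
-- runs  k ─X⁻¹→ n  into an inner subword  X v' X⁻¹  of w with v'[s](n) = n.
-- Either way the fixed point is explained by a nonempty subword.
module Submission where

open import Defs
open import Data.Nat using (ℕ; suc; _<_; s≤s; z≤n)
open import Data.Nat.Properties using (_≟_; ≤-totalOrder; <-irrefl; <-asym)
open import Data.Nat.DivMod using (m<n⇒m%n≡m)
open import Data.List using (List; []; _∷_; _++_; _∷ʳ_; map; concat; concatMap; reverse; length)
open import Data.List.Properties using (++-assoc; ++-identityʳ; reverse-++; unfold-reverse; length-reverse)
open import Data.List.Reverse using (Reverse; []; _∶_∶ʳ_; reverseView)
open import Data.List.Extrema ≤-totalOrder using (max; xs≤max)
open import Data.List.Membership.Propositional using (_∈_)
open import Data.List.Membership.Propositional.Properties using (∈-map⁺; ∈-map⁻; ∈-++⁺ˡ; ∈-++⁺ʳ; ∈-concat⁺′)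
open import Data.List.Membership.DecPropositional _≟_ using (_∈?_)
open import Data.List.Relation.Unary.Any using (here; there)
open import Data.List.Relation.Unary.All using (lookup)
open import Data.List.Relation.Binary.Subset.Propositional using (_⊆_)
open import Data.List.Relation.Binary.Pointwise.Properties using () renaming (refl to Pointwise-refl)
open import Data.Maybe using (just)
open import Data.Product using (Σ; _×_; _,_; proj₁; proj₂)
open import Data.Product.Properties using (,-injective)
open import Data.Sum using (inj₁; inj₂)
open import Data.Empty using (⊥-elim)
open import Relation.Nullary using (¬_; yes; no)
open import Relation.Binary.PropositionalEquality

-- Positions in lists: the path of w reads reverse w cyclically, and before
-- the first wrap-around the cyclic reading is plain indexing.

nth-at-length : ∀ {A : Set} (xs : List A) a ys → nth (xs ++ a ∷ ys) (length xs) ≡ just a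
nth-at-length []       a ys = refl
nth-at-length (_ ∷ xs) a ys = nth-at-length xs a ys

length-< : ∀ {A : Set} (xs : List A) a ys → length xs < length (xs ++ a ∷ ys)
length-< []       a ys = s≤s z≤n
length-< (_ ∷ xs) a ys = s≤s (length-< xs a ys)

cycNth-below : ∀ {A : Set} (xs : List A) {i} → i < length xs → cycNth xs i ≡ nth xs i
cycNth-below (x ∷ xs) i<len = cong (nth (x ∷ xs)) (m<n⇒m%n≡m i<len)

reverse-around : ∀ {A : Set} (u : List A) a v → reverse (u ++ a ∷ v) ≡ reverse v ++ a ∷ reverse u
reverse-around u a v = begin
  reverse (u ++ a ∷ v)               ≡⟨ reverse-++ u (a ∷ v) ⟩
  reverse (a ∷ v) ++ reverse u       ≡⟨ cong (_++ reverse u) (unfold-reverse a v) ⟩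
  (reverse v ∷ʳ a) ++ reverse u      ≡⟨ ++-assoc (reverse v) (a ∷ []) (reverse u) ⟩
  reverse v ++ a ∷ reverse u         ∎
  where open ≡-Reasoning

letter-after-suffix : ∀ {A : Set} (u : List A) a v → cycNth (reverse (u ++ a ∷ v)) (length v) ≡ just a
letter-after-suffix u a v = begin
  cycNth (reverse (u ++ a ∷ v)) (length v)
    ≡⟨ cong₂ cycNth (reverse-around u a v) (sym (length-reverse v)) ⟩
  cycNth (reverse v ++ a ∷ reverse u) (length (reverse v))
    ≡⟨ cycNth-below (reverse v ++ a ∷ reverse u) (length-< (reverse v) a (reverse u)) ⟩
  nth (reverse v ++ a ∷ reverse u) (length (reverse v))
    ≡⟨ nth-at-length (reverse v) a (reverse u) ⟩
  just a ∎
  where open ≡-Reasoning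

module _ {G : Perm → Set} where

  Reduced-tail : ∀ {a : Letter G} {v} → Reduced (a ∷ v) → Reduced v
  Reduced-tail {v = []}    _       = _
  Reduced-tail {v = _ ∷ _} (_ , r) = r

  Reduced-prefix : ∀ (u : Word G) {v} → Reduced (u ++ v) → Reduced u
  Reduced-prefix []          _        = _
  Reduced-prefix (_ ∷ [])    _        = _
  Reduced-prefix (_ ∷ b ∷ u) (ok , r) = ok , Reduced-prefix (b ∷ u) r

  Reduced-adjacent : ∀ (u : Word G) {a b v} → Reduced (u ++ a ∷ b ∷ v) → OkPair a b
  Reduced-adjacent []          r = proj₁ r
  Reduced-adjacent (_ ∷ [])    r = Reduced-adjacent [] (proj₂ r)
  Reduced-adjacent (_ ∷ c ∷ u) r = Reduced-adjacent (c ∷ u) (proj₂ r)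

  Reduced-last-two : ∀ (u : Word G) {a b} → Reduced ((u ∷ʳ a) ∷ʳ b) → OkPair a b
  Reduced-last-two u {a} {b} r = Reduced-adjacent u (subst Reduced (++-assoc u (a ∷ []) (b ∷ [])) r)

  inner-nonempty : ∀ u (v' : Word G) v → Reduced (u ++ X ∷ v' ++ X⁻¹ ∷ v) → ¬ v' ≡ []
  inner-nonempty u [] v r refl = Reduced-adjacent u r

  last-∈ : ∀ (u : Word G) {a} → a ∈ u ∷ʳ a
  last-∈ u = ∈-++⁺ʳ u (here refl)

  nonempty : ∀ {w : Word G} → ¬ InG w → ¬ w ≡ []
  nonempty notInG w≡[] = notInG (inj₁ w≡[])

  Eval-++⁻ : ∀ (u v : Word G) {t x z} → Eval (u ++ v) t x z → Σ ℕ λ y → Eval v t x y × Eval u t y z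
  Eval-++⁻ []      v e              = _ , e , refl
  Eval-++⁻ (a ∷ u) v (l , e , step) =
    let y , ev , eu = Eval-++⁻ u v e in y , ev , l , eu , step

  Eval-++⁺ : ∀ (u v : Word G) {t x y z} → Eval v t x y → Eval u t y z → Eval (u ++ v) t x z
  Eval-++⁺ []      v ev refl             = ev
  Eval-++⁺ (a ∷ u) v ev (l , eu , step) = l , Eval-++⁺ u v ev eu , step

  Eval-snoc⁻ : ∀ (u : Word G) {a t x z} → Eval (u ∷ʳ a) t x z → Σ ℕ λ y → Step a t x y × Eval u t y z
  Eval-snoc⁻ u {a} e with Eval-++⁻ u (a ∷ []) e
  ... | y , (_ , refl , step) , eu = y , step , eu

  path-follows-suffix : ∀ (u v : Word G) {t m y} → Eval v t m y → PathAt (u ++ v) t m (length v) y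
  path-follows-suffix u []      refl             = p0
  path-follows-suffix u (a ∷ v) {t} {m} (l , e , step) =
    pS (subst (λ w → PathAt w t m (length v) l) (++-assoc u (a ∷ []) v)
              (path-follows-suffix (u ∷ʳ a) v e))
       (letter-after-suffix u a v) step

  -- m ∈ fix(w[t]) is explained over t₀ ⊆ t: some point of path(w, t, m) is
  -- fixed by w'[t₀] for a nonempty subword w' (the clause defining ≤Q).
  Explained : Word G → PFun → PFun → ℕ → Set
  Explained w t t₀ m =
    Σ (Word G) λ w' → NonemptySubword w' w × Σ ℕ λ j → InSet w t m j × Fix w' t₀ j

  explained-by-itself : ∀ {w : Word G} {t t₀ m} → ¬ w ≡ [] → Fix w t₀ m → Explained w t t₀ m
  explained-by-itself {w} w≢[] fx = w , (w≢[] , [] , [] , sym (++-identityʳ w)) , _ , (0 , p0) , fx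

  LetterEq-refl : ∀ {a : Letter G} → LetterEq a a
  LetterEq-refl {gl _ _ _} = λ _ → refl
  LetterEq-refl {X}        = _
  LetterEq-refl {X⁻¹}      = _

  ∈W-reflexive : ∀ {w : Word G} {ws} → w ∈ ws → w ∈W ws
  ∈W-reflexive {w} w∈ = w , w∈ , Pointwise-refl LetterEq-refl

  ≤Q-refl : (p : Cond G) → p ≤Q p
  ≤Q-refl p =
    (λ x∈ → x∈) ,
    ∈W-reflexive ,
    (λ w∈ m fx → explained-by-itself (nonempty (proj₂ (lookup (F-ok p) w∈))) fx)

add-functional : ∀ {f n k} → ¬ n ∈ map proj₁ f → Functional f → Functional ((n , k) ∷ f)
add-functional n∉dom fun (here refl) (here refl) = refl
add-functional n∉dom fun (here refl) (there q)   = ⊥-elim (n∉dom (∈-map⁺ proj₁ q))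
add-functional n∉dom fun (there q)   (here refl) = ⊥-elim (n∉dom (∈-map⁺ proj₁ q))
add-functional n∉dom fun (there q)   (there q')  = fun q q'

add-injective : ∀ {f n k} → ¬ k ∈ map proj₂ f → Injective f → Injective ((n , k) ∷ f)
add-injective k∉ran inj (here refl) (here refl) = refl
add-injective k∉ran inj (here refl) (there q)   = ⊥-elim (k∉ran (∈-map⁺ proj₂ q))
add-injective k∉ran inj (there q)   (here refl) = ⊥-elim (k∉ran (∈-map⁺ proj₂ q))
add-injective k∉ran inj (there q)   (there q')  = inj q q'

module Extension {G : Perm → Set} (p : Cond G) (n : ℕ) where

  U : List ℕ
  U = n ∷ (map proj₁ (s p) ++ map proj₂ (s p))

  n∈U : n ∈ U
  n∈U = here refl

  dom⊆U : ∀ {a b} → (a , b) ∈ s p → a ∈ U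
  dom⊆U ab∈ = there (∈-++⁺ˡ (∈-map⁺ proj₁ ab∈))

  ran⊆U : ∀ {a b} → (a , b) ∈ s p → b ∈ U
  ran⊆U ab∈ = there (∈-++⁺ʳ (map proj₁ (s p)) (∈-map⁺ proj₂ ab∈))

  module _ (k : ℕ) where

    s' : PFun
    s' = (n , k) ∷ s p

    dom'⊆U : ∀ {a b} → (a , b) ∈ s' → a ∈ U
    dom'⊆U (here refl) = n∈U
    dom'⊆U (there ab∈) = dom⊆U ab∈

    Avoids : Perm → Set
    Avoids π = (¬ to π k ∈ U) × (∀ {l} → l ∈ U → ¬ to π l ≡ k)

    record Fresh (L : Word G) : Set where
      field
        outside : ¬ k ∈ U
        moved   : ∀ {σ g ne} → gl σ g ne ∈ L → ¬ to σ k ≡ k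
        single  : ∀ {σ g ne} → gl σ g ne ∈ L → Avoids σ
        double  : ∀ {σ g ne τ g′ ne′} → gl σ g ne ∈ L → gl τ g′ ne′ ∈ L → Avoids (σ ∘P τ)

    -- Where an evaluation under s^p starting in U can end: in U, or one
    -- G-letter away from U (a reduced word has no two adjacent G-letters).
    data Landing : Word G → ℕ → Set where
      inU    : ∀ {v y} → y ∈ U → Landing v y
      afterG : ∀ {σ g ne v l} → l ∈ U → Landing (gl σ g ne ∷ v) (to σ l)

    landing : ∀ {v x y} → Reduced v → x ∈ U → Eval v (s p) x y → Landing v y
    landing {[]}          _ x∈U refl             = inU x∈U
    landing {X ∷ _}       _ _   (_ , _ , step)   = inU (ran⊆U step)
    landing {X⁻¹ ∷ _}     _ _   (_ , _ , step)   = inU (dom⊆U step)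
    landing {gl _ _ _ ∷ v} r x∈U (_ , e , refl) with landing (Reduced-tail r) x∈U e
    ... | inU l∈U = afterG l∈U
    ... | afterG _ = ⊥-elim (proj₁ r)

    data Trace : Word G → ℕ → ℕ → Set where
      old        : ∀ {v x y} → Eval v (s p) x y → ¬ y ≡ k → Trace v x y
      enter      : ∀ {v x y} → Eval v (s p) x n → y ≡ k → Trace (X ∷ v) x y
      enter-then : ∀ {σ g ne v x y} → Eval v (s p) x n → y ≡ to σ k → Trace (gl σ g ne ∷ X ∷ v) x y

    module Analysis {L : Word G} (fresh : Fresh L) where
      open Fresh fresh

      old-pair : ∀ {a b} → (a , b) ∈ s' → ¬ b ≡ k → (a , b) ∈ s p
      old-pair (here refl) b≢k = ⊥-elim (b≢k refl)
      old-pair (there ab∈) _   = ab∈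

      -- One more letter of a traced evaluation; the freshness of k rules out
      -- every continuation after the new pair except one G-letter.
      trace-step : ∀ {a v x l y} → Reduced (a ∷ v) → a ∷ v ⊆ L → x ∈ U →
        Trace v x l → Step a s' l y → Trace (a ∷ v) x y
      trace-step {X}   _ _ _ (old e _) (here refl) = enter e refl
      trace-step {X}   _ _ _ (old e _) (there st)  = old (_ , e , st) (λ { refl → outside (ran⊆U st) })
      trace-step {X⁻¹} _ _ _ (old e l≢k) st        =
        old (_ , e , old-pair st l≢k) (λ { refl → outside (dom⊆U (old-pair st l≢k)) })
      trace-step {gl σ g ne} r ⊆L x∈U (old e _) refl with landing (Reduced-tail r) x∈U e
      ... | inU l∈U  = old (_ , e , refl) (proj₂ (single (⊆L (here refl))) l∈U)
      ... | afterG _ = ⊥-elim (proj₁ r)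
      trace-step {X}         _ _ _ (enter _ refl) st   = ⊥-elim (outside (dom'⊆U st))
      trace-step {X⁻¹}       r _ _ (enter _ _)    _    = ⊥-elim (proj₁ r)
      trace-step {gl _ _ _}  _ _ _ (enter e refl) refl = enter-then e refl
      trace-step {X}   _ ⊆L _ (enter-then _ refl) st =
        ⊥-elim (proj₁ (single (⊆L (there (here refl)))) (dom'⊆U st))
      trace-step {X⁻¹} _ ⊆L _ (enter-then _ refl) st =
        ⊥-elim (proj₁ (single (⊆L (there (here refl)))) (ran⊆U (old-pair st (moved (⊆L (there (here refl)))))))
      trace-step {gl _ _ _} r _ _ (enter-then _ _) _ = ⊥-elim (proj₁ r)

      trace : ∀ {v x y} → Reduced v → v ⊆ L → x ∈ U → Eval v s' x y → Trace v x y
      trace {[]}    _ _  x∈U refl         = old refl (λ { refl → outside x∈U })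
      trace {a ∷ v} r ⊆L x∈U (_ , e , st) =
        trace-step r ⊆L x∈U (trace (Reduced-tail r) (λ q → ⊆L (there q)) x∈U e) st

      loop-explains : ∀ (u v' v : Word G) {w m} → w ≡ u ++ X ∷ v' ++ X⁻¹ ∷ v → Reduced w →
        Eval v s' m k → Fix v' (s p) n → Explained w s' (s p) m
      loop-explains u v' v {m = m} refl r ev fx =
        v' , (inner-nonempty u v' v r , u ∷ʳ X , X⁻¹ ∷ v , sym (++-assoc u (X ∷ []) (v' ++ X⁻¹ ∷ v))) ,
        n , (length (X⁻¹ ∷ v) , path) , fx
        where
          path : PathAt (u ++ X ∷ v' ++ X⁻¹ ∷ v) s' m (length (X⁻¹ ∷ v)) n
          path = subst (λ w → PathAt w s' m (length (X⁻¹ ∷ v)) n) (++-assoc u (X ∷ v') (X⁻¹ ∷ v))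
                       (path-follows-suffix (u ++ X ∷ v') (X⁻¹ ∷ v) (k , ev , here refl))

      -- Fixed point m ∈ U: the path never leaves s^p.
      explain-inside : ∀ {w m} → Reduced w → ¬ InG w → w ⊆ L → m ∈ U → Fix w s' m →
        Explained w s' (s p) m
      explain-inside r notInG ⊆L m∈U fx with trace r ⊆L m∈U fx
      ... | old e _           = explained-by-itself (nonempty notInG) e
      ... | enter _ refl      = ⊥-elim (outside m∈U)
      ... | enter-then _ refl = ⊥-elim (proj₁ (single (⊆L (here refl))) m∈U)

      -- First letter X⁻¹ at m = k: the path is  k ─X⁻¹→ n ─v'→ n ─X→ k.
      explain-via-X⁻¹ : ∀ {w₀} → Reduced (w₀ ∷ʳ X⁻¹) → w₀ ∷ʳ X⁻¹ ⊆ L → Eval w₀ s' n k →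
        Explained (w₀ ∷ʳ X⁻¹) s' (s p) k
      explain-via-X⁻¹ {w₀} r ⊆L e with trace (Reduced-prefix w₀ r) (λ q → ⊆L (∈-++⁺ˡ q)) n∈U e
      ... | old _ k≢k          = ⊥-elim (k≢k refl)
      ... | enter {v'} e' _    = loop-explains [] v' [] refl r refl e'
      ... | enter-then _ k≡τk  = ⊥-elim (moved (⊆L (here refl)) (sym k≡τk))

      -- First letter σ with σm ∈ U: the rest of the path never leaves s^p.
      explain-σ-into-U : ∀ {w₀ σ g ne m} → Reduced (w₀ ∷ʳ gl σ g ne) → ¬ InG (w₀ ∷ʳ gl σ g ne) →
        w₀ ∷ʳ gl σ g ne ⊆ L → to σ m ∈ U → Eval w₀ s' (to σ m) m →
        Explained (w₀ ∷ʳ gl σ g ne) s' (s p) m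
      explain-σ-into-U {w₀} {σ} {g} {ne} r notInG ⊆L σm∈U e
        with trace (Reduced-prefix w₀ r) (λ q → ⊆L (∈-++⁺ˡ q)) σm∈U e
      ... | old e' _          = explained-by-itself (nonempty notInG) (Eval-++⁺ w₀ (gl σ g ne ∷ []) (_ , refl , refl) e')
      ... | enter _ refl      = ⊥-elim (proj₁ (single (⊆L (last-∈ w₀))) σm∈U)
      ... | enter-then _ refl = ⊥-elim (proj₁ (double (⊆L (last-∈ w₀)) (⊆L (here refl))) σm∈U)

      -- Below the letters X⁻¹ σ, a path under s^p from n cannot reach a
      -- point m ∉ U with σm = k: it would end in U or at τl with l ∈ U.
      not-old-before-X⁻¹σ : ∀ {w₁ σ g ne m} → Reduced ((w₁ ∷ʳ X⁻¹) ∷ʳ gl σ g ne) →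
        (w₁ ∷ʳ X⁻¹) ∷ʳ gl σ g ne ⊆ L → ¬ m ∈ U → to σ m ≡ k → ¬ Eval w₁ (s p) n m
      not-old-before-X⁻¹σ {w₁} r ⊆L m∉U σm≡k e
        with landing (Reduced-prefix w₁ (Reduced-prefix (w₁ ∷ʳ X⁻¹) r)) n∈U e
      ... | inU m∈U    = m∉U m∈U
      ... | afterG l∈U = proj₂ (double (⊆L (last-∈ (w₁ ∷ʳ X⁻¹))) (⊆L (here refl))) l∈U σm≡k

      -- First letters σ then X⁻¹ with σm = k: the path is
      -- m ─σ→ k ─X⁻¹→ n ─v'→ n ─X→ k ─τ→ m.
      explain-via-σX⁻¹ : ∀ {w₁ σ g ne m} → Reduced ((w₁ ∷ʳ X⁻¹) ∷ʳ gl σ g ne) →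
        (w₁ ∷ʳ X⁻¹) ∷ʳ gl σ g ne ⊆ L → ¬ m ∈ U → to σ m ≡ k → Eval w₁ s' n m →
        Explained ((w₁ ∷ʳ X⁻¹) ∷ʳ gl σ g ne) s' (s p) m
      explain-via-σX⁻¹ {w₁} {σ} {g} {ne} r ⊆L m∉U σm≡k e
        with trace (Reduced-prefix w₁ (Reduced-prefix (w₁ ∷ʳ X⁻¹) r)) (λ q → ⊆L (∈-++⁺ˡ (∈-++⁺ˡ q))) n∈U e
      ... | old e' _     = ⊥-elim (not-old-before-X⁻¹σ r ⊆L m∉U σm≡k e')
      ... | enter _ refl = ⊥-elim (moved (⊆L (last-∈ (w₁ ∷ʳ X⁻¹))) σm≡k)
      ... | enter-then {τ} {g′} {ne′} {v'} e' refl =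
        loop-explains (gl τ g′ ne′ ∷ []) v' (gl σ g ne ∷ [])
          (cong (λ z → gl τ g′ ne′ ∷ X ∷ z) (++-assoc v' (X⁻¹ ∷ []) (gl σ g ne ∷ [])))
          r (_ , refl , sym σm≡k) e'

      -- First letter σ with σm ∉ U: the second letter must be X⁻¹ and σm = k.
      explain-σ-outside : ∀ {w₀ σ g ne m} → Reverse w₀ → Reduced (w₀ ∷ʳ gl σ g ne) →
        ¬ InG (w₀ ∷ʳ gl σ g ne) → w₀ ∷ʳ gl σ g ne ⊆ L → ¬ m ∈ U → ¬ to σ m ∈ U →
        Eval w₀ s' (to σ m) m → Explained (w₀ ∷ʳ gl σ g ne) s' (s p) m
      explain-σ-outside {σ = σ} {g} {ne} [] _ notInG _ _ _ _ = ⊥-elim (notInG (inj₂ (σ , g , ne , refl)))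
      explain-σ-outside (w₁ ∶ _ ∶ʳ a₂) r notInG ⊆L m∉U σm∉U e with Eval-snoc⁻ w₁ e
      explain-σ-outside (w₁ ∶ _ ∶ʳ X) _ _ _ _ σm∉U _ | _ , st , _ = ⊥-elim (σm∉U (dom'⊆U st))
      explain-σ-outside (w₁ ∶ _ ∶ʳ X⁻¹) _ _ _ _ σm∉U _ | _ , there st , _ = ⊥-elim (σm∉U (ran⊆U st))
      explain-σ-outside (w₁ ∶ _ ∶ʳ X⁻¹) r _ ⊆L m∉U _ _ | _ , here eq , e₁ with ,-injective eq
      ... | refl , σm≡k = explain-via-σX⁻¹ r ⊆L m∉U σm≡k e₁
      explain-σ-outside (w₁ ∶ _ ∶ʳ gl _ _ _) r _ _ _ _ _ | _ = ⊥-elim (Reduced-last-two w₁ r)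

      explain-outside : ∀ {w m} → Reverse w → Reduced w → ¬ InG w → w ⊆ L → ¬ m ∈ U →
        Fix w s' m → Explained w s' (s p) m
      explain-outside [] _ notInG _ _ _ = ⊥-elim (notInG (inj₁ refl))
      explain-outside (w₀ ∶ _ ∶ʳ a₁) r notInG ⊆L m∉U fx with Eval-snoc⁻ w₀ fx
      explain-outside (w₀ ∶ _ ∶ʳ X) _ _ _ m∉U _ | _ , st , _ = ⊥-elim (m∉U (dom'⊆U st))
      explain-outside (w₀ ∶ _ ∶ʳ X⁻¹) _ _ _ m∉U _ | _ , there st , _ = ⊥-elim (m∉U (ran⊆U st))
      explain-outside (w₀ ∶ _ ∶ʳ X⁻¹) r _ ⊆L _ _ | _ , here refl , e = explain-via-X⁻¹ r ⊆L e
      explain-outside {m = m} (w₀ ∶ rs ∶ʳ gl σ g ne) r notInG ⊆L m∉U _ | _ , refl , e with to σ m ∈? U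
      ... | yes σm∈U = explain-σ-into-U r notInG ⊆L σm∈U e
      ... | no σm∉U  = explain-σ-outside rs r notInG ⊆L m∉U σm∉U e

      explain : ∀ {w m} → Reduced w → ¬ InG w → w ⊆ L → Fix w s' m → Explained w s' (s p) m
      explain {w} {m} r notInG ⊆L fx with m ∈? U
      ... | yes m∈U = explain-inside r notInG ⊆L m∈U fx
      ... | no m∉U  = explain-outside (reverseView w) r notInG ⊆L m∉U fx

    module _ (n∉dom : ¬ n ∈ map proj₁ (s p)) (fresh : Fresh (concat (F p))) where

      extension : Cond G
      extension = record
        { s = s' ; s-fun = add-functional n∉dom (s-fun p)
        ; s-inj = add-injective (λ k∈ran → Fresh.outside fresh (there (∈-++⁺ʳ _ k∈ran))) (s-inj p)
        ; F = F p ; F-ok = F-ok p }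

      extension-≤ : extension ≤Q p
      extension-≤ =
        there ,
        ∈W-reflexive ,
        (λ w∈ m fx → let r , notInG = lookup (F-ok p) w∈ in
           Analysis.explain fresh r notInG (λ a∈ → ∈-concat⁺′ a∈ w∈) fx)

above : List ℕ → ℕ
above xs = suc (max 0 xs)

below-above : ∀ {x xs} → x ∈ xs → x < above xs
below-above {xs = xs} x∈ = s≤s (lookup (xs≤max 0 xs) x∈)

module Choice {G : Perm → Set} (cof : Cofinitary G) (p : Cond G) (n : ℕ) (L : Word G) where
  open Extension p n using (U; Avoids; Fresh)

  -- The points whose choice as k would make π fail to avoid k.
  spoilers : Perm → List ℕ
  spoilers π = map (from π) U ++ map (to π) U

  -- For a G-letter σ also a bound on the fixed points of σ.
  letter-spoilers : Letter G → List ℕ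
  letter-spoilers (gl σ g ne) = proj₁ (cof σ g ne) ∷ spoilers σ
  letter-spoilers _           = []

  pair-spoilers : Letter G → Letter G → List ℕ
  pair-spoilers (gl σ _ _) (gl τ _ _) = spoilers (σ ∘P τ)
  pair-spoilers _          _          = []

  forbidden : List ℕ
  forbidden = U ++ (concatMap letter-spoilers L ++ concatMap (λ a → concatMap (pair-spoilers a) L) L)

  k : ℕ
  k = above forbidden

  k-allowed : ¬ k ∈ forbidden
  k-allowed k∈ = <-irrefl refl (below-above k∈)

  letter-forbidden : ∀ {a x} → a ∈ L → x ∈ letter-spoilers a → x ∈ forbidden
  letter-forbidden a∈ x∈ = ∈-++⁺ʳ U (∈-++⁺ˡ (∈-concat⁺′ x∈ (∈-map⁺ letter-spoilers a∈)))

  pair-forbidden : ∀ {a b x} → a ∈ L → b ∈ L → x ∈ pair-spoilers a b → x ∈ forbidden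
  pair-forbidden {a} a∈ b∈ x∈ = ∈-++⁺ʳ U (∈-++⁺ʳ (concatMap letter-spoilers L)
    (∈-concat⁺′ (∈-concat⁺′ x∈ (∈-map⁺ (pair-spoilers a) b∈)) (∈-map⁺ (λ a → concatMap (pair-spoilers a) L) a∈)))

  avoids : ∀ π → ¬ k ∈ spoilers π → Avoids k π
  avoids π k∉ =
    (λ πk∈U → k∉ (∈-++⁺ˡ (subst (_∈ map (from π) U) (from-to π k) (∈-map⁺ (from π) πk∈U)))) ,
    (λ l∈U πl≡k → k∉ (∈-++⁺ʳ (map (from π) U) (subst (_∈ map (to π) U) πl≡k (∈-map⁺ (to π) l∈U))))

  -- k exceeds the bound on the fixed points of σ, so σ moves k.
  moves : ∀ {σ g ne} → gl σ g ne ∈ L → ¬ to σ k ≡ k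
  moves {σ} {g} {ne} σ∈ σk≡k =
    <-asym (proj₂ (cof σ g ne) k σk≡k) (below-above (letter-forbidden σ∈ (here refl)))

  fresh : Fresh k L
  fresh = record
    { outside = λ k∈U → k-allowed (∈-++⁺ˡ k∈U)
    ; moved   = moves
    ; single  = λ {σ} σ∈ → avoids σ (λ k∈ → k-allowed (letter-forbidden σ∈ (there k∈)))
    ; double  = λ {σ} {_} {_} {τ} σ∈ τ∈ → avoids (σ ∘P τ) (λ k∈ → k-allowed (pair-forbidden σ∈ τ∈ k∈))
    }

dom-witness : ∀ (f : PFun) {n} → n ∈ map proj₁ f → Σ ℕ λ b → (n , b) ∈ f
dom-witness f n∈ with ∈-map⁻ proj₁ n∈
... | (_ , b) , nb∈ , refl = b , nb∈

lemma3p3 : (G : Perm → Set) → IsSubgroup G → Cofinitary G →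
    (n : ℕ) → Dense {G} (InDom n)
lemma3p3 G _ cof n p with n ∈? map proj₁ (s p)
... | yes n∈dom = p , ≤Q-refl p , dom-witness (s p) n∈dom
... | no n∉dom  = extension k n∉dom fresh , extension-≤ k n∉dom fresh , k , here refl
  where
    open Choice cof p n (concat (F p))
    open Extension p n
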